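{- If $G$ is a connected graph and $G'$ is a connected isometric subgraph of $G$, then $\mu(G)\ge\mu(G')$.
   Context: A subgraph $G'$ of $G$ is isometric if $d_{G'}(u,v)=d_G(u,v)$ for all $u,v\in V(G')$. For a connected graph $G$ and $X\subseteq V(G)$, two vertices $x,y\in X$ are $X$-visible if there is a shortest $x,y$-path $P$ in $G$ with $V(P)\cap X=\{x,y\}$; $X$ is a mutual-visibility set if every two vertices of $X$ are $X$-visible; $\mu(G)$ is the largest size of a mutual-visibility set of $G$. -}

module Defs where

open import Data.Nat using (ℕ; zero; suc; _≤_)
open import Data.Fin using (Fin)
open import Data.Fin.Subset using (Subset; _∈_; ∣_∣)
open import Data.List using (List; []; _∷_)
open import Data.List.Membership.Propositional renaming (_∈_ to _∈ₗ_)
open import Data.Product using (Σ; ∃; _×_; _,_)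
open import Data.Sum using (_⊎_)
open import Relation.Binary.PropositionalEquality using (_≡_)
open import Relation.Nullary using (¬_)
open import Function.Definitions using (Injective)

record Graph (n : ℕ) : Set₁ where
  field
    Adj     : Fin n → Fin n → Set
    sym     : ∀ {u v} → Adj u v → Adj v u
    irrefl  : ∀ {u} → ¬ Adj u u
open Graph public

module _ {n : ℕ} (G : Graph n) where

  data Walk : Fin n → Fin n → Set where
    nil  : (u : Fin n) → Walk u u
    cons : {u w v : Fin n} → Adj G u w → Walk w v → Walk u v

  len : {u v : Fin n} → Walk u v → ℕ
  len (nil _) = zero
  len (cons _ p) = suc (len p)

  verts : {u v : Fin n} → Walk u v → List (Fin n)
  verts (nil u) = u ∷ []
  verts (cons {u} _ p) = u ∷ verts p

  Connected : Set
  Connected = ∀ u v → Walk u v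

  IsShortest : {u v : Fin n} → Walk u v → Set
  IsShortest {u} {v} p = ∀ (q : Walk u v) → len p ≤ len q

  Dist : Fin n → Fin n → ℕ → Set
  Dist u v k = Σ (Walk u v) λ p → IsShortest p × len p ≡ k

  Visible : Subset n → Fin n → Fin n → Set
  Visible X x y = Σ (Walk x y) λ P → IsShortest P ×
    (∀ z → z ∈ₗ verts P → z ∈ X → z ≡ x ⊎ z ≡ y)

  IsMutualVisibility : Subset n → Set
  IsMutualVisibility X = ∀ x y → x ∈ X → y ∈ X → Visible X x y

  IsMu : ℕ → Set
  IsMu k = (Σ (Subset n) λ X → IsMutualVisibility X × ∣ X ∣ ≡ k)
         × (∀ X → IsMutualVisibility X → ∣ X ∣ ≤ k)

IsSubgraph : {m n : ℕ} → Graph m → Graph n → (Fin m → Fin n) → Set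
IsSubgraph G' G f = Injective _≡_ _≡_ f × (∀ {a b} → Adj G' a b → Adj G (f a) (f b))

IsIsometric : {m n : ℕ} → Graph m → Graph n → (Fin m → Fin n) → Set
IsIsometric G' G f = ∀ a b k k' → Dist G' a b k → Dist G (f a) (f b) k' → k ≡ k'

-- An isometric embedding f : G' → G sends shortest walks of G' to shortest walks of G, and
-- since f is injective, a vertex of f(P) lies in f(X) only if the corresponding vertex of P
-- lies in X. Hence f maps every mutual-visibility set of G' onto one of G of the same size.
module Submission where

open import Defs hiding (sym)
open import Data.Nat using (ℕ; zero; suc; _≤_; _<_; _≤?_; z≤n; s≤s; s≤s⁻¹)
open import Data.Nat.Properties using (≤-refl; ≤-trans; <-≤-trans; ≰⇒>)
open import Data.Fin using (Fin; zero; suc)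
open import Data.Fin.Properties using (suc-injective)
open import Data.Fin.Subset using (Subset; _∈_; _∉_; _⊂_; ∣_∣; ⊥; ⁅_⁆; _∪_; inside; outside)
open import Data.Fin.Subset.Properties
  using (∉⊥; x∈⁅x⁆; x∈⁅y⁆⇒x≡y; x∈p∪q⁺; x∈p∪q⁻; q⊆p∪q; p⊂q⇒∣p∣<∣q∣)
open import Data.Vec using ([]; _∷_; here; there)
open import Data.List using (_∷_; map)
open import Data.List.Membership.Propositional using () renaming (_∈_ to _∈ₗ_)
open import Data.List.Membership.Propositional.Properties using (∈-map⁻)
open import Data.Product using (Σ; _×_; _,_)
open import Data.Sum using (_⊎_; inj₁; inj₂)
open import Function using (_∘_)
open import Function.Definitions using (Injective)
open import Relation.Nullary using (¬_; contradiction)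
open import Relation.Nullary.Decidable using (decidable-stable)
open import Relation.Binary.PropositionalEquality using (_≡_; refl; cong; sym; subst)

private variable m n : ℕ

image : (Fin m → Fin n) → Subset m → Subset n
image f []            = ⊥
image f (outside ∷ X) = image (f ∘ suc) X
image f (inside ∷ X)  = ⁅ f zero ⁆ ∪ image (f ∘ suc) X

∈-image⁺ : (f : Fin m → Fin n) {X : Subset m} {a : Fin m} → a ∈ X → f a ∈ image f X
∈-image⁺ f {outside ∷ X} (there a∈X) = ∈-image⁺ (f ∘ suc) a∈X
∈-image⁺ f {inside ∷ X}  here        = x∈p∪q⁺ (inj₁ (x∈⁅x⁆ (f zero)))
∈-image⁺ f {inside ∷ X}  (there a∈X) = x∈p∪q⁺ (inj₂ (∈-image⁺ (f ∘ suc) a∈X))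

∈-image⁻ : (f : Fin m → Fin n) (X : Subset m) {z : Fin n} → z ∈ image f X →
  Σ (Fin m) λ a → a ∈ X × f a ≡ z
∈-image⁻ f [] z∈ = contradiction z∈ ∉⊥
∈-image⁻ f (outside ∷ X) z∈ with ∈-image⁻ (f ∘ suc) X z∈
... | a , a∈X , fa≡z = suc a , there a∈X , fa≡z
∈-image⁻ f (inside ∷ X) z∈ with x∈p∪q⁻ ⁅ f zero ⁆ (image (f ∘ suc) X) z∈
... | inj₁ z∈⁅f0⁆ = zero , here , sym (x∈⁅y⁆⇒x≡y (f zero) z∈⁅f0⁆)
... | inj₂ z∈rest with ∈-image⁻ (f ∘ suc) X z∈rest
...   | a , a∈X , fa≡z = suc a , there a∈X , fa≡z

∣X∣≤∣image∣ : (f : Fin m → Fin n) → Injective _≡_ _≡_ f → (X : Subset m) → ∣ X ∣ ≤ ∣ image f X ∣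
∣X∣≤∣image∣ f inj []            = z≤n
∣X∣≤∣image∣ f inj (outside ∷ X) = ∣X∣≤∣image∣ (f ∘ suc) (suc-injective ∘ inj) X
∣X∣≤∣image∣ f inj (inside ∷ X)  =
  ≤-trans (s≤s (∣X∣≤∣image∣ (f ∘ suc) (suc-injective ∘ inj) X)) (p⊂q⇒∣p∣<∣q∣ grows)
  where
  grows : image (f ∘ suc) X ⊂ ⁅ f zero ⁆ ∪ image (f ∘ suc) X
  grows = q⊆p∪q ⁅ f zero ⁆ _ , f zero , x∈p∪q⁺ (inj₁ (x∈⁅x⁆ (f zero))) , f0∉
    where
    f0∉ : f zero ∉ image (f ∘ suc) X
    f0∉ f0∈ with ∈-image⁻ (f ∘ suc) X f0∈
    ... | a , _ , fsa≡f0 with inj fsa≡f0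
    ... | ()

-- Adjacency is not decidable, so a shortest walk exists only up to double negation;
-- this suffices because it is only ever used to prove a decidable inequality.
module _ (G : Graph n) where

  ¬¬-shortest-< : ∀ {u v} k (q : Walk G u v) → len G q < k → ¬ ¬ Σ (Walk G u v) (IsShortest G)
  ¬¬-shortest-< (suc k) q q<1+k noShortest =
    noShortest (q , λ r → decidable-stable (len G q ≤? len G r) λ q≰r →
      ¬¬-shortest-< k r (<-≤-trans (≰⇒> q≰r) (s≤s⁻¹ q<1+k)) noShortest)

  ¬¬-shortest : ∀ {u v} → Walk G u v → ¬ ¬ Σ (Walk G u v) (IsShortest G)
  ¬¬-shortest q = ¬¬-shortest-< (suc (len G q)) q ≤-refl

GraphHom : Graph m → Graph n → (Fin m → Fin n) → Set
GraphHom G' G f = ∀ {a b} → Adj G' a b → Adj G (f a) (f b)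

module _ {G' : Graph m} {G : Graph n} {f : Fin m → Fin n} (hom : GraphHom G' G f) where

  mapWalk : ∀ {a b} → Walk G' a b → Walk G (f a) (f b)
  mapWalk (nil a)    = nil (f a)
  mapWalk (cons e p) = cons (hom e) (mapWalk p)

  len-mapWalk : ∀ {a b} (p : Walk G' a b) → len G (mapWalk p) ≡ len G' p
  len-mapWalk (nil a)    = refl
  len-mapWalk (cons e p) = cong suc (len-mapWalk p)

  verts-mapWalk : ∀ {a b} (p : Walk G' a b) → verts G (mapWalk p) ≡ map f (verts G' p)
  verts-mapWalk (nil a)    = refl
  verts-mapWalk (cons e p) = cong (f _ ∷_) (verts-mapWalk p)

  mapWalk-isShortest : IsIsometric G' G f → ∀ {a b} {p : Walk G' a b} →
    IsShortest G' p → IsShortest G (mapWalk p)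
  mapWalk-isShortest iso {a} {b} {p} p-short q =
    subst (_≤ len G q) (sym (len-mapWalk p)) (decidable-stable (len G' p ≤? len G q) λ p≰q →
      ¬¬-shortest G q λ (s , s-short) →
        p≰q (subst (_≤ len G q) (sym (iso a b _ _ (p , p-short , refl) (s , s-short , refl))) (s-short q)))

  image-isMutualVisibility : Injective _≡_ _≡_ f → IsIsometric G' G f → (X : Subset m) →
    IsMutualVisibility G' X → IsMutualVisibility G (image f X)
  image-isMutualVisibility inj iso X X-mv x y x∈ y∈
    with ∈-image⁻ f X x∈ | ∈-image⁻ f X y∈
  ... | a , a∈X , refl | b , b∈X , refl with X-mv a b a∈X b∈X
  ... | P , P-short , P-avoids = mapWalk P , mapWalk-isShortest iso P-short , mapWalk-avoids
    where
    mapWalk-avoids : ∀ z → z ∈ₗ verts G (mapWalk P) → z ∈ image f X → z ≡ f a ⊎ z ≡ f b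
    mapWalk-avoids z z∈P z∈fX
      with ∈-map⁻ f (subst (z ∈ₗ_) (verts-mapWalk P) z∈P) | ∈-image⁻ f X z∈fX
    ... | w , w∈P , refl | c , c∈X , fc≡fw with inj fc≡fw
    ... | refl with P-avoids c w∈P c∈X
    ...   | inj₁ refl = inj₁ refl
    ...   | inj₂ refl = inj₂ refl

lemma4p1 : {m n : ℕ} (G : Graph n) (G' : Graph m) (f : Fin m → Fin n) →
    Connected G → Connected G' → IsSubgraph G' G f → IsIsometric G' G f →
    (μG μG' : ℕ) → IsMu G μG → IsMu G' μG' → μG' ≤ μG
lemma4p1 G G' f _ _ (inj , hom) iso μG μG' (_ , μG-max) ((X , X-mv , ∣X∣≡μG') , _) =
  subst (_≤ μG) ∣X∣≡μG'
    (≤-trans (∣X∣≤∣image∣ f inj X) (μG-max (image f X) (image-isMutualVisibility hom inj iso X X-mv)))
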